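{- Let $(p,X)\in\{(3,3),(5,4),(5,5),(7,4),(7,5),(11,5)\}$. For every $X$-element subset $S$ of $\mathbb{Z}/p^2\mathbb{Z}$ whose elements are pairwise distinct modulo $p$, there exist $k_1,k_2\in\mathbb{Z}/p^2\mathbb{Z}$ with $k_1\equiv k_2\not\equiv 0\pmod p$ such that the set $\{(i,j)\in S^2: i-j=k_1\}$ is empty and the set $\{(i,j)\in S^2: i-j=k_2\}$ has exactly one element. -}

module Defs where

open import Data.Nat using (ℕ; _+_; _*_; _∸_; NonZero; _≡ᵇ_)
open import Data.Nat.DivMod using (_%_)
open import Data.Fin using (Fin; toℕ; fromℕ<)
open import Data.Fin.Subset using (Subset; _∈_; ∣_∣)
open import Data.List using (List; length; filter; allFin; cartesianProduct)
open import Data.Product using (_×_; _,_)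
open import Relation.Binary.PropositionalEquality using (_≡_)
open import Relation.Nullary using (¬_)
open import Relation.Unary using (Pred)
open import Data.Fin.Subset.Properties using (_∈?_)
open import Data.Fin using (_≟_)
open import Relation.Nullary.Decidable using (_×-dec_)

ℤmod : ℕ → Set
ℤmod n = Fin n

[_]ₘ : ∀ {n} .{{_ : NonZero n}} → ℕ → Fin n
[_]ₘ {n} m = fromℕ< (Data.Nat.DivMod.m%n<n m n)

_-ₘ_ : ∀ {n} .{{_ : NonZero n}} → Fin n → Fin n → Fin n
_-ₘ_ {n} i j = [ toℕ i + (n ∸ toℕ j) ]ₘ

-- congruence mod p of elements of ℤ/p²ℤ (well defined since p ∣ p²)
_≡[mod_]_ : ∀ {n} → Fin n → (p : ℕ) .{{_ : NonZero p}} → Fin n → Set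
i ≡[mod p ] j = toℕ i % p ≡ toℕ j % p

pairsWithDiff : ∀ {n} .{{_ : NonZero n}} → Subset n → Fin n → List (Fin n × Fin n)
pairsWithDiff {n} S k =
  filter (λ { (i , j) → (i ∈? S) ×-dec (j ∈? S) ×-dec ((i -ₘ j) ≟ k) })
         (cartesianProduct (allFin n) (allFin n))

DistinctMod : ∀ {n} → (p : ℕ) .{{_ : NonZero p}} → Subset n → Set
DistinctMod p S = ∀ i j → i ∈ S → j ∈ S → i ≡[mod p ] j → i ≡ j

data Admissible : ℕ → ℕ → Set where
  a33  : Admissible 3 3
  a54  : Admissible 5 4
  a55  : Admissible 5 5
  a74  : Admissible 7 4
  a75  : Admissible 7 5
  a115 : Admissible 11 5

zeroₘ : ∀ n .{{_ : NonZero n}} → Fin n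
zeroₘ n = [ 0 ]ₘ

{-# OPTIONS --safe #-}
-- An affine map x ↦ u (x − c) of ℤ/p² with u a unit multiplies every difference by u, and
-- multiplication by u permutes the residue classes mod p and fixes 0; so the conclusion holds
-- for a set as soon as it holds for its image.  Two elements y₁, y₂ of S are incongruent
-- mod p, hence y₂ − y₁ is a unit and such a map sends y₁, y₂ to 0, 1.  The other X − 2
-- points are then handled through their residues mod p: either the residues collide; or some
-- nonzero residue r is the difference of exactly one pair of residues, and then the
-- difference d of the corresponding pair of points occurs exactly once while d + p, which
-- lies in the same class, does not occur; or every lift of the residues to ℤ/p² is checked
-- directly.  Invertibility of the units and this case analysis are decided by evaluation.
module Submission where

open import Defs
open import Data.Bool using (true; false)
open import Data.Fin as Fin using (Fin; toℕ; fromℕ<)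
open import Data.Fin.Properties using (toℕ-fromℕ<; toℕ-injective; toℕ<n)
open import Data.Fin.Subset using (Subset; ∣_∣; inside; outside)
open import Data.Fin.Subset.Properties using (_∈?_; drop-there)
open import Data.List
  using (List; []; _∷_; [_]; _++_; map; filter; length; replicate; upTo; allFin; tabulate;
         cartesianProduct; cartesianProductWith)
open import Data.List.Membership.Propositional using (_∈_; find)
open import Data.List.Membership.Propositional.Properties
  using (∈-cartesianProductWith⁺; ∈-upTo⁺; ∈-map⁺; ∈-filter⁻)
open import Data.List.Properties
  using (map-++; map-∘; map-cong; map-id; map-id-local; map-tabulate; length-map;
         filter-++; filter-none; filter-reject; filter-accept; filter-≐)
open import Data.List.Relation.Unary.All as All using (All; []; _∷_; all?)
import Data.List.Relation.Unary.All.Properties as All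
open import Data.List.Relation.Unary.AllPairs as AllPairs using (AllPairs; []; _∷_; allPairs?)
import Data.List.Relation.Unary.AllPairs.Properties as AllPairs
open import Data.List.Relation.Unary.Any using (Any; here; any?; satisfied)
open import Data.Nat using (ℕ; suc; _+_; _*_; _∸_; _<_; _≟_; NonZero; >-nonZero⁻¹; ≢-nonZero⁻¹)
open import Data.Nat.DivMod
open import Data.Nat.Divisibility using (_∣_; m∣m*n)
open import Data.Nat.Properties
  using (+-assoc; +-comm; *-comm; *-assoc; *-distribˡ-+; *-identityˡ; *-zeroʳ; m∸n+n≡m; m+[n∸m]≡n;
         m<m*n; m*n≢0; ≤-<-trans; n≢0⇒n>0; allUpTo?; anyUpTo?)
open import Data.Product using (Σ-syntax; ∃; _×_; _,_; proj₁; proj₂)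
open import Data.Sum using (_⊎_; inj₁; inj₂)
open import Data.Vec using ([]; _∷_; here; there)
open import Function using (_∘_; id)
open import Level using (0ℓ)
open import Relation.Binary using (Rel)
open import Relation.Binary.PropositionalEquality
  using (_≡_; _≢_; refl; sym; trans; cong; cong₂; subst; setoid; ≢-sym; module ≡-Reasoning)
open import Relation.Nullary
  using (¬_; Dec; yes; no; does; _because_; contradiction; ¬?; _×-dec_; _⊎-dec_; _→-dec_)
open import Relation.Nullary.Reflects using (invert)
open import Relation.Unary using (Pred; Decidable)

module _ {A B : Set} {P : Pred B 0ℓ} (P? : Decidable P) (f : A → B) where

  length-filter-map : ∀ xs → length (filter P? (map f xs)) ≡ length (filter (P? ∘ f) xs)
  length-filter-map []       = refl
  length-filter-map (x ∷ xs) with does (P? (f x))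
  ... | true  = cong suc (length-filter-map xs)
  ... | false = length-filter-map xs

module _ {A : Set} {P Q : Pred A 0ℓ} (P? : Decidable P) (Q? : Decidable Q) where

  filter-filter : (∀ {x} → P x → Q x) → ∀ xs → filter P? (filter Q? xs) ≡ filter P? xs
  filter-filter P⇒Q []       = refl
  filter-filter P⇒Q (x ∷ xs) with Q? x
  ... | no ¬qx = trans (filter-filter P⇒Q xs) (sym (filter-reject P? (¬qx ∘ P⇒Q)))
  ... | yes _ with does (P? x)
  ...   | true  = cong (x ∷_) (filter-filter P⇒Q xs)
  ...   | false = filter-filter P⇒Q xs

module _ {A : Set} {P Q : Pred A 0ℓ} {R : Pred (A × A) 0ℓ}
         (P? : Decidable P) (Q? : Decidable Q) (R? : Decidable R) where

  private
    PQR? : Decidable (λ xy → P (proj₁ xy) × Q (proj₂ xy) × R xy)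
    PQR? (x , y) = P? x ×-dec Q? y ×-dec R? (x , y)

  filter-cartesianProduct : ∀ xs ys →
    filter PQR? (cartesianProduct xs ys) ≡ filter R? (cartesianProduct (filter P? xs) (filter Q? ys))
  filter-cartesianProduct []       ys = refl
  filter-cartesianProduct (x ∷ xs) ys with P? x
  ... | yes px = begin
    filter PQR? (map (x ,_) ys ++ cartesianProduct xs ys)
      ≡⟨ filter-++ PQR? (map (x ,_) ys) _ ⟩
    filter PQR? (map (x ,_) ys) ++ filter PQR? (cartesianProduct xs ys)
      ≡⟨ cong₂ _++_ (row ys) (filter-cartesianProduct xs ys) ⟩
    filter R? (map (x ,_) (filter Q? ys)) ++ filter R? (cartesianProduct (filter P? xs) (filter Q? ys))
      ≡⟨ filter-++ R? (map (x ,_) (filter Q? ys)) _ ⟨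
    filter R? (map (x ,_) (filter Q? ys) ++ cartesianProduct (filter P? xs) (filter Q? ys)) ∎
    where
    open ≡-Reasoning
    row : ∀ ys → filter PQR? (map (x ,_) ys) ≡ filter R? (map (x ,_) (filter Q? ys))
    row []       = refl
    row (y ∷ ys) with P? x | Q? y
    ... | no ¬px | _     = contradiction px ¬px
    ... | yes _  | no _  = row ys
    ... | yes _  | yes _ with does (R? (x , y))
    ...   | true  = cong ((x , y) ∷_) (row ys)
    ...   | false = row ys
  ... | no ¬px = trans (filter-++ PQR? (map (x ,_) ys) _)
    (trans (cong (_++ _) (filter-none PQR? (All.map⁺ (All.universal (λ _ → ¬px ∘ proj₁) ys))))
           (filter-cartesianProduct xs ys))

cartesianProductWith-map :
  ∀ {A A′ B B′ C C′ : Set} {f : A → B → C} {f′ : A′ → B′ → C′}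
    {g : A′ → A} {g′ : B′ → B} {h : C′ → C} →
  (∀ x y → f (g x) (g′ y) ≡ h (f′ x y)) →
  ∀ xs ys → cartesianProductWith f (map g xs) (map g′ ys) ≡ map h (cartesianProductWith f′ xs ys)
cartesianProductWith-map eq []       ys = refl
cartesianProductWith-map {f = f} {f′} {g} {g′} {h} eq (x ∷ xs) ys = begin
  map (f (g x)) (map g′ ys) ++ cartesianProductWith f (map g xs) (map g′ ys)
    ≡⟨ cong₂ _++_ row (cartesianProductWith-map eq xs ys) ⟩
  map h (map (f′ x) ys) ++ map h (cartesianProductWith f′ xs ys)
    ≡⟨ map-++ h (map (f′ x) ys) _ ⟨
  map h (map (f′ x) ys ++ cartesianProductWith f′ xs ys) ∎
  where
  open ≡-Reasoning
  row : map (f (g x)) (map g′ ys) ≡ map h (map (f′ x) ys)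
  row = trans (sym (map-∘ ys)) (trans (map-cong (eq x) ys) (map-∘ ys))

length≡1⇒singleton : ∀ {A : Set} {xs : List A} → length xs ≡ 1 → ∃ λ x → xs ≡ [ x ]
length≡1⇒singleton {xs = x ∷ []} refl = x , refl

allPairs-discharge : ∀ {A : Set} {P : Pred A 0ℓ} {R : Rel A 0ℓ} {xs} →
  All P xs → AllPairs (λ x y → P x → P y → R x y) xs → AllPairs R xs
allPairs-discharge []         []         = []
allPairs-discharge (px ∷ pxs) (rx ∷ rxs) =
  All.zipWith (λ (py , r) → r px py) (pxs , rx) ∷ allPairs-discharge pxs rxs

choices : ∀ {A : Set} → List (List A) → List (List A)
choices []         = [ [] ]
choices (xs ∷ xss) = cartesianProductWith _∷_ xs (choices xss)

count : ℕ → List ℕ → ℕ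
count k = length ∘ filter (_≟ k)

count-∷-≡ : ∀ {k} xs → count k (k ∷ xs) ≡ suc (count k xs)
count-∷-≡ {k} _ = cong length (filter-accept (_≟ k) refl)

count-∷-≢ : ∀ {k x} xs → x ≢ k → count k (x ∷ xs) ≡ count k xs
count-∷-≢ {k} _ x≢k = cong length (filter-reject (_≟ k) x≢k)

count-map : ∀ (f : ℕ → ℕ) {k xs} → All (λ x → f x ≡ f k → x ≡ k) xs →
            count (f k) (map f xs) ≡ count k xs
count-map f {k} {[]}     []                  = refl
count-map f {k} {x ∷ xs} (fx≡fk⇒x≡k ∷ injective) with x ≟ k
... | yes refl = trans (count-∷-≡ (map f xs)) (trans (cong suc (count-map f injective)) (sym (count-∷-≡ xs)))
... | no x≢k   = trans (count-∷-≢ (map f xs) (x≢k ∘ fx≡fk⇒x≡k))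
                       (trans (count-map f injective) (sym (count-∷-≢ xs x≢k)))

-- Arithmetic modulo d

module Modular (d : ℕ) .{{_ : NonZero d}} where

  open ≡-Reasoning

  -- b is reduced before it is subtracted from d, so that the laws below hold for all
  -- naturals and not only for residues.
  infixl 6 _⊖_
  _⊖_ : ℕ → ℕ → ℕ
  a ⊖ b = (a + (d ∸ b % d)) % d

  differences : List ℕ → List ℕ
  differences zs = cartesianProductWith _⊖_ zs zs

  0%d≡0 : 0 % d ≡ 0
  0%d≡0 = m<n⇒m%n≡m (>-nonZero⁻¹ d)

  %≡1⇒≡1% : ∀ {x} → x % d ≡ 1 → x % d ≡ 1 % d
  %≡1⇒≡1% {x} x≡1 = trans x≡1 (sym (m<n⇒m%n≡m (subst (_< d) x≡1 (m%n<n x d))))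

  %-+-cong : ∀ {a b c e} → a % d ≡ b % d → c % d ≡ e % d → (a + c) % d ≡ (b + e) % d
  %-+-cong {a} {b} {c} {e} a≈b c≈e = begin
    (a + c) % d           ≡⟨ %-distribˡ-+ a c d ⟩
    (a % d + c % d) % d   ≡⟨ cong₂ (λ x y → (x + y) % d) a≈b c≈e ⟩
    (b % d + e % d) % d   ≡⟨ %-distribˡ-+ b e d ⟨
    (b + e) % d           ∎

  %-*-cong : ∀ {a b c e} → a % d ≡ b % d → c % d ≡ e % d → (a * c) % d ≡ (b * e) % d
  %-*-cong {a} {b} {c} {e} a≈b c≈e = begin
    (a * c) % d           ≡⟨ %-distribˡ-* a c d ⟩
    (a % d * (c % d)) % d ≡⟨ cong₂ (λ x y → (x * y) % d) a≈b c≈e ⟩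
    (b % d * (e % d)) % d ≡⟨ %-distribˡ-* b e d ⟨
    (b * e) % d           ∎

  *-inverse : ∀ {u w} x → u * w % d ≡ 1 % d → u * (w * x) % d ≡ x % d
  *-inverse {u} {w} x uw≈1 = begin
    u * (w * x) % d ≡⟨ cong (_% d) (*-assoc u w x) ⟨
    u * w * x % d   ≡⟨ %-*-cong uw≈1 refl ⟩
    1 * x % d       ≡⟨ cong (_% d) (*-identityˡ x) ⟩
    x % d           ∎

  *-cancelˡ-% : ∀ {u w a b} → u * w % d ≡ 1 % d → w * a % d ≡ w * b % d → a % d ≡ b % d
  *-cancelˡ-% {u} {w} {a} {b} uw≈1 wa≈wb = begin
    a % d           ≡⟨ *-inverse {u} {w} a uw≈1 ⟨
    u * (w * a) % d ≡⟨ %-*-cong {u} refl wa≈wb ⟩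
    u * (w * b) % d ≡⟨ *-inverse {u} {w} b uw≈1 ⟩
    b % d           ∎

  ⊖-< : ∀ a b → a ⊖ b < d
  ⊖-< a b = m%n<n _ d

  ⊖-% : ∀ a b → (a ⊖ b) % d ≡ a ⊖ b
  ⊖-% a b = m%n%n≡m%n _ d

  differences-< : ∀ zs → All (_< d) (differences zs)
  differences-< zs = All.cartesianProductWith⁺ (setoid ℕ) (setoid ℕ) _⊖_ zs zs (λ {a} {b} _ _ → ⊖-< a b)

  ⊖-+ : ∀ a b → (a ⊖ b + b) % d ≡ a % d
  ⊖-+ a b = begin
    (a ⊖ b + b) % d               ≡⟨ %-+-cong (⊖-% a b) (sym (m%n%n≡m%n b d)) ⟩
    (a + (d ∸ b % d) + b % d) % d ≡⟨ cong (_% d) (+-assoc a _ _) ⟩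
    (a + (d ∸ b % d + b % d)) % d ≡⟨ cong (λ x → (a + x) % d) (m∸n+n≡m (m%n≤n b d)) ⟩
    (a + d) % d                   ≡⟨ [m+n]%n≡m%n a d ⟩
    a % d                         ∎

  +-⊖ : ∀ a b → (a + b) ⊖ b ≡ a % d
  +-⊖ a b = begin
    (a + b + (d ∸ b % d)) % d       ≡⟨ %-+-cong (%-+-cong {a} refl (sym (m%n%n≡m%n b d))) refl ⟩
    (a + b % d + (d ∸ b % d)) % d   ≡⟨ cong (_% d) (+-assoc a _ _) ⟩
    (a + (b % d + (d ∸ b % d))) % d ≡⟨ cong (λ x → (a + x) % d) (m+[n∸m]≡n (m%n≤n b d)) ⟩
    (a + d) % d                     ≡⟨ [m+n]%n≡m%n a d ⟩
    a % d                           ∎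

  ⊖-unique : ∀ {z a} b → (z + b) % d ≡ a % d → z % d ≡ a ⊖ b
  ⊖-unique {z} b z+b≈a = trans (sym (+-⊖ z b)) (%-+-cong z+b≈a refl)

  +-cancelʳ-% : ∀ {a b} c → (a + c) % d ≡ (b + c) % d → a % d ≡ b % d
  +-cancelʳ-% {b = b} c a+c≈b+c = trans (⊖-unique c a+c≈b+c) (+-⊖ b c)

  ⊖-self : ∀ a → a ⊖ a ≡ 0
  ⊖-self a = trans (sym (⊖-unique {0} a refl)) 0%d≡0

  ⊖-translate : ∀ a b c → (a ⊖ c) ⊖ (b ⊖ c) ≡ a ⊖ b
  ⊖-translate a b c = trans (sym (⊖-unique (b ⊖ c) (+-cancelʳ-% c sum≈))) (⊖-% a b)
    where
    sum≈ : (a ⊖ b + (b ⊖ c) + c) % d ≡ (a ⊖ c + c) % d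
    sum≈ = begin
      (a ⊖ b + (b ⊖ c) + c) % d ≡⟨ cong (_% d) (+-assoc (a ⊖ b) _ c) ⟩
      (a ⊖ b + (b ⊖ c + c)) % d ≡⟨ %-+-cong {a ⊖ b} refl (⊖-+ b c) ⟩
      (a ⊖ b + b) % d           ≡⟨ ⊖-+ a b ⟩
      a % d                     ≡⟨ ⊖-+ a c ⟨
      (a ⊖ c + c) % d           ∎

  *-⊖ : ∀ u a b → (u * a % d) ⊖ (u * b % d) ≡ u * (a ⊖ b) % d
  *-⊖ u a b = trans (sym (⊖-unique (u * b % d) sum≈)) (m%n%n≡m%n _ d)
    where
    sum≈ : (u * (a ⊖ b) % d + u * b % d) % d ≡ (u * a % d) % d
    sum≈ = begin
      (u * (a ⊖ b) % d + u * b % d) % d ≡⟨ %-+-cong (m%n%n≡m%n _ d) (m%n%n≡m%n _ d) ⟩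
      (u * (a ⊖ b) + u * b) % d         ≡⟨ cong (_% d) (*-distribˡ-+ u (a ⊖ b) b) ⟨
      (u * (a ⊖ b + b)) % d             ≡⟨ %-*-cong {u} refl (⊖-+ a b) ⟩
      (u * a) % d                       ≡⟨ m%n%n≡m%n _ d ⟨
      (u * a % d) % d                   ∎

%-reduce : ∀ {d} p .{{_ : NonZero p}} .{{_ : NonZero d}} → p ∣ d →
           ∀ {a b} → a % d ≡ b % d → a % p ≡ b % p
%-reduce {d} p p∣d {a} {b} a≈b = begin
  a % p     ≡⟨ m∣n⇒o%n%m≡o%m p d a p∣d ⟨
  a % d % p ≡⟨ cong (_% p) a≈b ⟩
  b % d % p ≡⟨ m∣n⇒o%n%m≡o%m p d b p∣d ⟩
  b % p     ∎
  where open ≡-Reasoning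

module _ {d} p .{{_ : NonZero p}} .{{_ : NonZero d}} (p∣d : p ∣ d) where

  private
    module D = Modular d
    module P = Modular p

  ⊖-reduce : ∀ a b → (a D.⊖ b) % p ≡ (a % p) P.⊖ (b % p)
  ⊖-reduce a b = P.⊖-unique (b % p) (begin
    (a D.⊖ b + b % p) % p ≡⟨ P.%-+-cong {a D.⊖ b} refl (m%n%n≡m%n b p) ⟩
    (a D.⊖ b + b) % p     ≡⟨ %-reduce p p∣d (D.⊖-+ a b) ⟩
    a % p                 ≡⟨ m%n%n≡m%n a p ⟨
    a % p % p             ∎)
    where open ≡-Reasoning

-- Subsets of Fin n as lists of residues

length-filter-∈-tabulate-suc : ∀ {n} s (S : Subset n) →
  length (filter (_∈? (s ∷ S)) (tabulate Fin.suc)) ≡ length (filter (_∈? S) (allFin n))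
length-filter-∈-tabulate-suc {n} s S = begin
  length (filter (_∈? (s ∷ S)) (tabulate Fin.suc))
    ≡⟨ cong (length ∘ filter (_∈? (s ∷ S))) (map-tabulate id Fin.suc) ⟨
  length (filter (_∈? (s ∷ S)) (map Fin.suc (allFin n)))
    ≡⟨ length-filter-map (_∈? (s ∷ S)) Fin.suc (allFin n) ⟩
  length (filter ((_∈? (s ∷ S)) ∘ Fin.suc) (allFin n))
    ≡⟨ cong length (filter-≐ _ (_∈? S) (drop-there , there) (allFin n)) ⟩
  length (filter (_∈? S) (allFin n)) ∎
  where open ≡-Reasoning

length-filter-∈-allFin : ∀ {n} (S : Subset n) → length (filter (_∈? S) (allFin n)) ≡ ∣ S ∣
length-filter-∈-allFin []            = refl
length-filter-∈-allFin (inside ∷ S)  =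
  cong suc (trans (length-filter-∈-tabulate-suc inside S) (length-filter-∈-allFin S))
length-filter-∈-allFin (outside ∷ S) =
  trans (length-filter-∈-tabulate-suc outside S) (length-filter-∈-allFin S)

module _ {n} .{{_ : NonZero n}} where

  open Modular n

  elements : Subset n → List ℕ
  elements S = map toℕ (filter (_∈? S) (allFin n))

  length-elements : ∀ S → length (elements S) ≡ ∣ S ∣
  length-elements S = trans (length-map toℕ (filter (_∈? S) (allFin n))) (length-filter-∈-allFin S)

  elements-incongruent : ∀ p .{{_ : NonZero p}} {S} → DistinctMod p S →
                         AllPairs (λ a b → a % p ≢ b % p) (elements S)
  elements-incongruent p {S} distinct = AllPairs.map⁺ (allPairs-discharge (All.all-filter (_∈? S) (allFin n))
    (AllPairs.filter⁺ (_∈? S) (AllPairs.tabulate⁺ λ i≢j i∈S j∈S → i≢j ∘ distinct _ _ i∈S j∈S)))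

  toℕ-difference : ∀ (i j : Fin n) → toℕ (i -ₘ j) ≡ toℕ i ⊖ toℕ j
  toℕ-difference i j =
    trans (toℕ-fromℕ< _) (cong (λ x → (toℕ i + (n ∸ x)) % n) (sym (m<n⇒m%n≡m (toℕ<n j))))

  length-pairsWithDiff : ∀ S k → length (pairsWithDiff S k) ≡ count (toℕ k) (differences (elements S))
  length-pairsWithDiff S k = begin
    length (pairsWithDiff S k)
      ≡⟨ cong length (filter-cartesianProduct (_∈? S) (_∈? S) R? (allFin n) (allFin n)) ⟩
    length (filter R? pairs)
      ≡⟨ cong length (filter-≐ R? ((_≟ toℕ k) ∘ diff) (cong toℕ , toℕ-injective) pairs) ⟩
    length (filter ((_≟ toℕ k) ∘ diff) pairs)
      ≡⟨ length-filter-map (_≟ toℕ k) diff pairs ⟨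
    count (toℕ k) (map diff pairs)
      ≡⟨ cong (count (toℕ k)) (cartesianProductWith-map (λ i j → sym (toℕ-difference i j)) xs xs) ⟨
    count (toℕ k) (differences (elements S)) ∎
    where
    open ≡-Reasoning
    xs : List (Fin n)
    xs = filter (_∈? S) (allFin n)
    pairs : List (Fin n × Fin n)
    pairs = cartesianProduct xs xs
    R? : Decidable (λ ij → proj₁ ij -ₘ proj₂ ij ≡ k)
    R? (i , j) = i -ₘ j Fin.≟ k
    diff : Fin n × Fin n → ℕ
    diff (i , j) = toℕ (i -ₘ j)

-- Gaps in the difference multiset of a subset of ℤ/p²

module _ (p : ℕ) .{{_ : NonZero p}} where

  private
    n : ℕ
    n = p * p

    instance
      n≢0 : NonZero n
      n≢0 = m*n≢0 p p

    p∣n : p ∣ n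
    p∣n = m∣m*n p

    module P = Modular p

  open Modular n

  PairwiseIncongruent : List ℕ → Set
  PairwiseIncongruent = AllPairs (λ a b → a % p ≢ b % p)

  record Gap (ds : List ℕ) : Set where
    field
      absent simple   : ℕ
      absent<n        : absent < n
      simple<n        : simple < n
      same-residue    : absent % p ≡ simple % p
      nonzero-residue : absent % p ≢ 0
      absent-count    : count absent ds ≡ 0
      simple-count    : count simple ds ≡ 1

  %n%p : ∀ x → x % n % p ≡ x % p
  %n%p x = m∣n⇒o%n%m≡o%m p n x p∣n

  unit-reduce : ∀ {u w} → u * w % n ≡ 1 → u * w % p ≡ 1 % p
  unit-reduce uw≡1 = %-reduce p p∣n (%≡1⇒≡1% uw≡1)

  lift-residue : ∀ k t → (k + t * p) % n % p ≡ k % p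
  lift-residue k t = trans (%n%p (k + t * p)) ([m+kn]%n≡m%n k t p)

  lift-≢ : ∀ {d} → d < n → 1 < p → (d + 1 * p) % n ≢ d
  lift-≢ {d} d<n 1<p d+p≡d = ≢-nonZero⁻¹ p (begin
    p           ≡⟨ m<n⇒m%n≡m (m<m*n p p 1<p) ⟨
    p % n       ≡⟨ cong (_% n) (+-comm 0 p) ⟩
    (1 * p) % n ≡⟨ +-cancelʳ-% d (begin
      (1 * p + d) % n ≡⟨ cong (_% n) (+-comm (1 * p) d) ⟩
      (d + 1 * p) % n ≡⟨ d+p≡d ⟩
      d               ≡⟨ m<n⇒m%n≡m d<n ⟨
      d % n           ∎) ⟩
    0 % n       ≡⟨ 0%d≡0 ⟩
    0           ∎)
    where open ≡-Reasoning

  gap-intro : ∀ {ds} k t → k < n → k % p ≢ 0 →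
              count k ds ≡ 1 → count ((k + t * p) % n) ds ≡ 0 → Gap ds
  gap-intro k t k<n k≢0 once never = record
    { absent = (k + t * p) % n ; simple = k ; absent<n = m%n<n _ n ; simple<n = k<n
    ; same-residue = lift-residue k t ; nonzero-residue = k≢0 ∘ trans (sym (lift-residue k t))
    ; absent-count = never ; simple-count = once }

  differences-translate : ∀ c zs → differences (map (_⊖ c) zs) ≡ differences zs
  differences-translate c zs =
    trans (cartesianProductWith-map {h = id} (λ a b → ⊖-translate a b c) zs zs) (map-id _)

  differences-scale : ∀ u zs →
    differences (map (λ x → u * x % n) zs) ≡ map (λ x → u * x % n) (differences zs)
  differences-scale u zs = cartesianProductWith-map (*-⊖ u) zs zs

  differences-reduce : ∀ zs → P.differences (map (_% p) zs) ≡ map (_% p) (differences zs)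
  differences-reduce zs = cartesianProductWith-map (λ a b → sym (⊖-reduce p p∣n a b)) zs zs

  gap-scale : ∀ {u w ds} → u * w % n ≡ 1 → All (_< n) ds → Gap ds → Gap (map (λ x → w * x % n) ds)
  gap-scale {u} {w} {ds} uw≡1 ds<n gap = record
    { absent = w * absent % n ; simple = w * simple % n
    ; absent<n = m%n<n _ n ; simple<n = m%n<n _ n
    ; same-residue = trans (%n%p (w * absent))
        (trans (P.%-*-cong {w} refl same-residue) (sym (%n%p (w * simple))))
    ; nonzero-residue = λ wa≡0 → nonzero-residue (trans
        (P.*-cancelˡ-% {u} {w} (unit-reduce {u} {w} uw≡1)
          (trans (sym (%n%p (w * absent))) (trans wa≡0 (sym w*0≡0))))
        P.0%d≡0)
    ; absent-count = trans (count-map (λ x → w * x % n) (injective absent<n)) absent-count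
    ; simple-count = trans (count-map (λ x → w * x % n) (injective simple<n)) simple-count }
    where
    open Gap gap
    w*0≡0 : w * 0 % p ≡ 0
    w*0≡0 = trans (cong (_% p) (*-zeroʳ w)) P.0%d≡0
    injective : ∀ {k} → k < n → All (λ x → w * x % n ≡ w * k % n → x ≡ k) ds
    injective k<n = All.map (λ x<n wx≡wk → trans (sym (m<n⇒m%n≡m x<n))
      (trans (*-cancelˡ-% {u} {w} (%≡1⇒≡1% uw≡1) wx≡wk) (m<n⇒m%n≡m k<n))) ds<n

  gap-unscale : ∀ {u w ds} → u * w % n ≡ 1 → All (_< n) ds → Gap (map (λ x → u * x % n) ds) → Gap ds
  gap-unscale {u} {w} {ds} uw≡1 ds<n gap =
    subst Gap (trans (sym (map-∘ ds)) (map-id-local (All.map cancel ds<n)))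
      (gap-scale {u} {w} uw≡1 (All.map⁺ (All.universal (λ _ → m%n<n _ n) ds)) gap)
    where
    cancel : ∀ {x} → x < n → w * (u * x % n) % n ≡ x
    cancel {x} x<n = begin
      w * (u * x % n) % n ≡⟨ %-*-cong {w} refl (m%n%n≡m%n (u * x) n) ⟩
      w * (u * x) % n     ≡⟨ *-inverse {w} {u} x (%≡1⇒≡1% (trans (cong (_% n) (*-comm w u)) uw≡1)) ⟩
      x % n               ≡⟨ m<n⇒m%n≡m x<n ⟩
      x                   ∎
      where open ≡-Reasoning

  normalise : ℕ → ℕ → ℕ → ℕ
  normalise u c x = u * (x ⊖ c) % n

  gap-normalise : ∀ {u w} c zs → u * w % n ≡ 1 →
                  Gap (differences (map (normalise u c) zs)) → Gap (differences zs)
  gap-normalise {u} {w} c zs uw≡1 gap =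
    subst Gap (differences-translate c zs) (gap-unscale {u} {w} uw≡1 (differences-< (map (_⊖ c) zs))
      (subst Gap (differences-scale u (map (_⊖ c) zs)) (subst (Gap ∘ differences) (map-∘ zs) gap)))

  normalise-head : ∀ {u y₁ y₂} rest → u * (y₂ ⊖ y₁) % n ≡ 1 →
                   map (normalise u y₁) (y₁ ∷ y₂ ∷ rest) ≡ 0 ∷ 1 ∷ map (normalise u y₁) rest
  normalise-head {u} {y₁} rest uw≡1 = cong₂ _∷_ u*0≡0 (cong (_∷ _) uw≡1)
    where
    u*0≡0 : u * (y₁ ⊖ y₁) % n ≡ 0
    u*0≡0 = trans (cong (λ x → u * x % n) (⊖-self y₁)) (trans (cong (_% n) (*-zeroʳ u)) 0%d≡0)

  incongruent-map : ∀ {f zs} → (∀ {a b} → f a % p ≡ f b % p → a % p ≡ b % p) →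
                    PairwiseIncongruent zs → PairwiseIncongruent (map f zs)
  incongruent-map reflect = AllPairs.map⁺ ∘ AllPairs.map (_∘ reflect)

  incongruent-normalise : ∀ {u w} c {zs} → u * w % n ≡ 1 → PairwiseIncongruent zs →
                          PairwiseIncongruent (map (normalise u c) zs)
  incongruent-normalise {u} {w} c uw≡1 = incongruent-map λ {a} {b} ua≈ub →
    translate-reflect (P.*-cancelˡ-% {w} {u} wu≡1
      (trans (sym (%n%p (u * (a ⊖ c)))) (trans ua≈ub (%n%p (u * (b ⊖ c))))))
    where
    wu≡1 : w * u % p ≡ 1 % p
    wu≡1 = unit-reduce {w} {u} (trans (cong (_% n) (*-comm w u)) uw≡1)
    translate-reflect : ∀ {a b} → (a ⊖ c) % p ≡ (b ⊖ c) % p → a % p ≡ b % p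
    translate-reflect {a} {b} a≈b = begin
      a % p           ≡⟨ %-reduce p p∣n (⊖-+ a c) ⟨
      (a ⊖ c + c) % p ≡⟨ P.%-+-cong a≈b refl ⟩
      (b ⊖ c + c) % p ≡⟨ %-reduce p p∣n (⊖-+ b c) ⟩
      b % p           ∎
      where open ≡-Reasoning

  difference-nonzero : ∀ {a b} → a % p ≢ b % p → (b ⊖ a) % p ≢ 0
  difference-nonzero {a} {b} a≉b b-a≡0 = a≉b (begin
    a % p           ≡⟨ P.%-+-cong {0} (trans P.0%d≡0 (sym b-a≡0)) refl ⟩
    (b ⊖ a + a) % p ≡⟨ %-reduce p p∣n (⊖-+ b a) ⟩
    b % p           ∎)
    where open ≡-Reasoning

  UnitsInvertible : Set
  UnitsInvertible = ∀ {w} → w < n → w % p ≢ 0 → ∃ λ u → u < n × u * w % n ≡ 1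

  NormalisedGaps : ℕ → Set
  NormalisedGaps m = ∀ rest → length rest ≡ m → All (_< n) rest →
    PairwiseIncongruent (0 ∷ 1 ∷ rest) → Gap (differences (0 ∷ 1 ∷ rest))

  gap-from-normalised : ∀ {m} → UnitsInvertible → NormalisedGaps m →
    ∀ zs → length zs ≡ 2 + m → PairwiseIncongruent zs → Gap (differences zs)
  gap-from-normalised units normalised zs@(y₁ ∷ y₂ ∷ rest) refl incongruent@((y₁≉y₂ ∷ _) ∷ _)
    with u , _ , uw≡1 ← units (⊖-< y₂ y₁) (difference-nonzero y₁≉y₂)
    = gap-normalise {u} {y₂ ⊖ y₁} y₁ zs uw≡1 (subst (Gap ∘ differences) (sym head≡)
        (normalised (map (normalise u y₁) rest) (length-map _ rest)
          (All.map⁺ (All.universal (λ _ → m%n<n _ n) rest))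
          (subst PairwiseIncongruent head≡ (incongruent-normalise {u} {y₂ ⊖ y₁} y₁ uw≡1 incongruent))))
    where head≡ = normalise-head {u} {y₁} {y₂} rest uw≡1

  HasSimpleNonzero : List ℕ → Set
  HasSimpleNonzero ds = Any (λ r → r ≢ 0 × count r ds ≡ 1) ds

  gap-from-residues : ∀ zs → HasSimpleNonzero (P.differences (map (_% p) zs)) → Gap (differences zs)
  gap-from-residues zs simple
    with r , r≢0 , r-once ← satisfied simple
    with d , fibre≡[d] ← length≡1⇒singleton (trans (sym (length-filter-map (_≟ r) (_% p) (differences zs)))
                                                   (trans (cong (count r) (sym (differences-reduce zs))) r-once))
    with d∈ds , d≡r ← ∈-filter⁻ ((_≟ r) ∘ (_% p)) (subst (d ∈_) (sym fibre≡[d]) (here refl))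
    = gap-intro d 1 d<n (r≢0 ∘ trans (sym d≡r)) (trans (count-fibre d d≡r) (count-∷-≡ {d} []))
        (trans (count-fibre _ (trans (lift-residue d 1) d≡r)) (count-∷-≢ [] (≢-sym (lift-≢ d<n 1<p))))
    where
    open ≡-Reasoning
    ds = differences zs
    d<n = All.lookup (differences-< zs) d∈ds
    1<p = ≤-<-trans (n≢0⇒n>0 (r≢0 ∘ trans (sym d≡r))) (m%n<n d p)
    count-fibre : ∀ k → k % p ≡ r → count k ds ≡ count k [ d ]
    count-fibre k k≡r = begin
      count k ds
        ≡⟨ cong length (filter-filter (_≟ k) ((_≟ r) ∘ (_% p)) (λ { refl → k≡r }) ds) ⟨
      length (filter (_≟ k) (filter ((_≟ r) ∘ (_% p)) ds))
        ≡⟨ cong (count k) fibre≡[d] ⟩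
      count k [ d ] ∎

  GapWitness : List ℕ → Set
  GapWitness ds =
    Any (λ k → k % p ≢ 0 × count k ds ≡ 1 × Any (λ t → count ((k + t * p) % n) ds ≡ 0) (upTo p)) ds

  gapWitness? : Decidable GapWitness
  gapWitness? ds = any? (λ k → ¬? (k % p ≟ 0) ×-dec count k ds ≟ 1 ×-dec
                               any? (λ t → count ((k + t * p) % n) ds ≟ 0) (upTo p)) ds

  gap-from-witness : ∀ zs → GapWitness (differences zs) → Gap (differences zs)
  gap-from-witness zs witness
    with k , k∈ds , k≢0 , once , lift ← find witness
    with t , never ← satisfied lift
    = gap-intro k t (All.lookup (differences-< zs) k∈ds) k≢0 once never

  residuePatterns : ℕ → List (List ℕ)
  residuePatterns m = choices (replicate m (upTo p))

  lifts : List ℕ → List (List ℕ)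
  lifts = choices ∘ map (λ c → map (λ t → c + t * p) (upTo p))

  ∈-residuePatterns : ∀ zs → map (_% p) zs ∈ residuePatterns (length zs)
  ∈-residuePatterns []       = here refl
  ∈-residuePatterns (z ∷ zs) = ∈-cartesianProductWith⁺ _∷_ (∈-upTo⁺ (m%n<n z p)) (∈-residuePatterns zs)

  ∈-lifts : ∀ {zs} → All (_< n) zs → zs ∈ lifts (map (_% p) zs)
  ∈-lifts []                   = here refl
  ∈-lifts {z ∷ _} (z<n ∷ zs<n) = ∈-cartesianProductWith⁺ _∷_ z∈ (∈-lifts zs<n)
    where
    z∈ : z ∈ map (λ t → z % p + t * p) (upTo p)
    z∈ = subst (_∈ map (λ t → z % p + t * p) (upTo p)) (sym (m≡m%n+[m/n]*n z p))
           (∈-map⁺ (λ t → z % p + t * p) (∈-upTo⁺ (m<n*o⇒m/o<n {n = p} z<n)))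

  Resolved : List ℕ → Set
  Resolved cs = ¬ AllPairs _≢_ (0 % p ∷ 1 % p ∷ cs)
              ⊎ HasSimpleNonzero (P.differences (0 % p ∷ 1 % p ∷ cs))
              ⊎ All (λ zs → GapWitness (differences (0 ∷ 1 ∷ zs))) (lifts cs)

  resolved? : Decidable Resolved
  resolved? cs = ¬? (allPairs? (λ a b → ¬? (a ≟ b)) (0 % p ∷ 1 % p ∷ cs))
              ⊎-dec any? (λ r → ¬? (r ≟ 0) ×-dec count r residueDifferences ≟ 1) residueDifferences
              ⊎-dec all? (λ zs → gapWitness? (differences (0 ∷ 1 ∷ zs))) (lifts cs)
    where residueDifferences = P.differences (0 % p ∷ 1 % p ∷ cs)

  normalised-gaps : ∀ {m} → All Resolved (residuePatterns m) → NormalisedGaps m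
  normalised-gaps resolved rest refl rest<n incongruent with All.lookup resolved (∈-residuePatterns rest)
  ... | inj₁ ¬distinct     = contradiction (AllPairs.map⁺ incongruent) ¬distinct
  ... | inj₂ (inj₁ simple) = gap-from-residues (0 ∷ 1 ∷ rest) simple
  ... | inj₂ (inj₂ lifted) = gap-from-witness (0 ∷ 1 ∷ rest) (All.lookup lifted (∈-lifts rest<n))

  unitsInvertible? : Dec UnitsInvertible
  unitsInvertible? = allUpTo? (λ w → ¬? (w % p ≟ 0) →-dec anyUpTo? (λ u → u * w % n ≟ 1) n) n

  allResolved? : ∀ m → Dec (All Resolved (residuePatterns m))
  allResolved? m = all? resolved? (residuePatterns m)

  subset-gap : ∀ {m} → UnitsInvertible → NormalisedGaps m →
    (S : Subset n) → ∣ S ∣ ≡ 2 + m → DistinctMod p S →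
    Σ[ k₁ ∈ Fin n ] Σ[ k₂ ∈ Fin n ]
      (k₁ ≡[mod p ] k₂) × ¬ (k₁ ≡[mod p ] zeroₘ n) ×
      (length (pairsWithDiff S k₁) ≡ 0) × (length (pairsWithDiff S k₂) ≡ 1)
  subset-gap units normalised S size distinct =
    fromℕ< absent<n , fromℕ< simple<n ,
    trans (residue absent<n) (trans same-residue (sym (residue simple<n))) ,
    (λ k₁≈0 → nonzero-residue (trans (sym (residue absent<n)) (trans k₁≈0 zero-residue))) ,
    trans (length-pairsWithDiff S _) (trans (cong (λ k → count k ds) (toℕ-fromℕ< absent<n)) absent-count) ,
    trans (length-pairsWithDiff S _) (trans (cong (λ k → count k ds) (toℕ-fromℕ< simple<n)) simple-count)
    where
    ds = differences (elements S)
    open Gap (gap-from-normalised units normalised (elements S) (trans (length-elements S) size)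
                                  (elements-incongruent p distinct))
    residue : ∀ {k} (k<n : k < n) → toℕ (fromℕ< k<n) % p ≡ k % p
    residue k<n = cong (_% p) (toℕ-fromℕ< k<n)
    zero-residue : toℕ (zeroₘ n) % p ≡ 0
    zero-residue = trans (cong (_% p) (trans (toℕ-fromℕ< _) 0%d≡0)) P.0%d≡0

-- Checking refl against does a? ≡ true evaluates only the boolean, which is much faster
-- here than reducing the From-yes type of from-yes.
from-does : ∀ {A : Set} (a? : Dec A) → does a? ≡ true → A
from-does (true because [a]) refl = invert [a]

lemma5p2 : (p X : ℕ) → Admissible p X → .{{_ : NonZero p}} →
           (S : Subset (p * p)) → ∣ S ∣ ≡ X → DistinctMod p S →
           Σ[ k₁ ∈ Fin (p * p) ] Σ[ k₂ ∈ Fin (p * p) ]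
             (k₁ ≡[mod p ] k₂) × ¬ (k₁ ≡[mod p ] zeroₘ (p * p) {{m*n≢0 p p}}) ×
             (length (pairsWithDiff {{m*n≢0 p p}} S k₁) ≡ 0) ×
             (length (pairsWithDiff {{m*n≢0 p p}} S k₂) ≡ 1)
lemma5p2 _ _ a33 = subset-gap 3 (from-does (unitsInvertible? 3) refl)
                                (normalised-gaps 3 (from-does (allResolved? 3 1) refl))
lemma5p2 _ _ a54 = subset-gap 5 (from-does (unitsInvertible? 5) refl)
                                (normalised-gaps 5 (from-does (allResolved? 5 2) refl))
lemma5p2 _ _ a55 = subset-gap 5 (from-does (unitsInvertible? 5) refl)
                                (normalised-gaps 5 (from-does (allResolved? 5 3) refl))
lemma5p2 _ _ a74 = subset-gap 7 (from-does (unitsInvertible? 7) refl)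
                                (normalised-gaps 7 (from-does (allResolved? 7 2) refl))
lemma5p2 _ _ a75 = subset-gap 7 (from-does (unitsInvertible? 7) refl)
                                (normalised-gaps 7 (from-does (allResolved? 7 3) refl))
lemma5p2 _ _ a115 = subset-gap 11 (from-does (unitsInvertible? 11) refl)
                                  (normalised-gaps 11 (from-does (allResolved? 11 3) refl))
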